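{- Let $n>1$, $q=2^n$, let $F$ be a field of characteristic $2$, $a\in F$ nonzero, $T(x)=\sum_{i=0}^{n-1}x^{2^i-1}$, $C(x)=x\,T(x)^{q+1}$. Let $e$ be a root of $C(x)+a$ in an algebraic closure $\overline F$ of $F$, and let $u\in\overline F$ satisfy $u^{q+1}+1/u^{q+1}=1/e$. Then the complete set of roots of $x^{q+1}+a^2x+a^2$ is $$\bigl\{\,e\,T(e)^2\,\langle\zeta u\rangle^{q-1} : \zeta\in\mu_{q+1}\,\bigr\},$$ and these $q+1$ values are distinct.
   Context: $\langle x\rangle=x+1/x$; $\mu_{q+1}$ is the set of $(q+1)$-th roots of unity in $\overline F$. -}

module Defs where

open import Level using (Level; _⊔_) renaming (suc to lsuc)
open import Algebra.Bundles using (CommutativeRing)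
open import Data.Nat using (ℕ; zero; suc; _∸_; _^_)
open import Data.List using (List; []; _∷_; length)
open import Data.Product using (∃)
open import Relation.Nullary using (¬_)

-- The inverse is given as a total
-- operation _⁻¹ (with the harmless convention 0⁻¹ ≈ 0) so that 1/x can be written.
record Field (c ℓ : Level) : Set (lsuc (c ⊔ ℓ)) where
  field
    commutativeRing : CommutativeRing c ℓ
  open CommutativeRing commutativeRing public
  field
    _⁻¹      : Carrier → Carrier
    ⁻¹-cong  : ∀ {x y} → x ≈ y → x ⁻¹ ≈ y ⁻¹
    1≉0      : ¬ (1# ≈ 0#)
    inverseʳ : ∀ x → ¬ (x ≈ 0#) → x * (x ⁻¹) ≈ 1#
    0⁻¹≈0    : 0# ⁻¹ ≈ 0#

module FieldOps {c ℓ} (K : Field c ℓ) where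
  open Field K

  pow : Carrier → ℕ → Carrier
  pow x zero    = 1#
  pow x (suc k) = x * pow x k

  -- evaluation of a monic polynomial  x^(length cs) + Σ_i cs[i] x^i
  evalCoeffs : List Carrier → Carrier → Carrier
  evalCoeffs []       x = 0#
  evalCoeffs (c ∷ cs) x = c + x * evalCoeffs cs x

  evalMonic : List Carrier → Carrier → Carrier
  evalMonic cs x = pow x (length cs) + evalCoeffs cs x

  ⟨_⟩ : Carrier → Carrier
  ⟨ x ⟩ = x + x ⁻¹

  T : ℕ → Carrier → Carrier
  T zero    x = 0#
  T (suc i) x = T i x + pow x ((2 ^ i) ∸ 1)

  C : ℕ → Carrier → Carrier
  C n x = x * pow (T n x) (suc (2 ^ n))

  μ : ℕ → Carrier → Set ℓ
  μ m ζ = pow ζ m ≈ 1#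

Char2 : ∀ {c ℓ} → Field c ℓ → Set ℓ
Char2 K = 1# + 1# ≈ 0#
  where open Field K

IsAlgClosed : ∀ {c ℓ} → Field c ℓ → Set (c ⊔ ℓ)
IsAlgClosed K = ∀ (c₀ : Carrier) (cs : List Carrier) →
                ∃ λ x → evalMonic (c₀ ∷ cs) x ≈ 0#
  where open Field K
        open FieldOps K

-- Put q = 2^n, τ = T(e) and L = e τ = Σ_{i<n} e^(2^i).  Substituting x = e τ² y turns the
-- polynomial into a nonzero multiple of Q(y) = (e y)^q y + L² y + e, and e Q(y) = 0 says
-- e y (1 + Tr t) = t for t = (e y)² + e y + e², where Tr x = Σ_{i<n} x^(2^i) is additive.
-- A root y determines z with z^(q-1) = y and z² t = 1 (z = y t^(q/2-1)), and z = ⟨b⟩ for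
-- a root b of b² + z b + 1.  Then 1/z = g + g² with g = 1/(b+1), so Tr t = (Tr (1/z))²
-- telescopes to (g + g^q)², and Q(y) = 0 reduces to the single condition 1/e = ⟨b^(q+1)⟩,
-- i.e. b^(q+1) ∈ {U, U⁻¹} for U = u^(q+1).  Conversely that condition makes ⟨b⟩^(q-1) a root.
-- Finally w = e (z^q + U z) is the one of b, b⁻¹ with w^(q+1) = U, so ζ = w/u ∈ μ_{q+1},
-- and since w is a function of z, hence of y, the q + 1 roots are distinct.
module Submission where

open import Defs
open import Data.Nat using (ℕ; suc; _<_; _^_; _∸_)
open import Data.Product using (_×_; ∃)
open import Relation.Nullary using (¬_)
open import Function.Bundles using (_⇔_)

open import Algebra.Bundles using (CommutativeRing)
import Algebra.Properties.CommutativeSemiring.Exp as Exp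
open import Algebra.Solver.Ring.AlmostCommutativeRing
  using (fromCommutativeSemiring; _-Raw-AlmostCommutative⟶_)
open import Data.Bool using (Bool; true; false)
open import Data.Bool.Properties using (xor-∧-commutativeRing)
open import Data.List using ([]; _∷_)
open import Data.Maybe using (Maybe; just; nothing)
open import Data.Nat using (zero; NonZero) renaming (_+_ to _+ℕ_; _*_ to _*ℕ_)
import Data.Nat.Properties as ℕ
open import Data.Product using (_,_; proj₁; proj₂)
open import Function.Bundles using (mk⇔; Equivalence)
open import Function.Construct.Composition using (_⇔-∘_)
open import Relation.Binary.PropositionalEquality using (_≡_)
  renaming (refl to ≡-refl; cong to ≡-cong)

module CharacteristicTwo {c ℓ} (K : Field c ℓ) (char2 : Char2 K) where
  open Field K
  open FieldOps K
  open import Relation.Binary.Reasoning.Setoid setoid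

  x+x≈0 : ∀ x → x + x ≈ 0#
  x+x≈0 x = begin
    x + x            ≈⟨ +-cong (*-identityˡ x) (*-identityˡ x) ⟨
    1# * x + 1# * x  ≈⟨ distribʳ x 1# 1# ⟨
    (1# + 1#) * x    ≈⟨ *-congʳ char2 ⟩
    0# * x           ≈⟨ zeroˡ x ⟩
    0#               ∎

  -- With coefficients in 𝔽₂ the ring solver proves the polynomial identities that hold in
  -- every commutative ring of characteristic 2.
  private
    module 𝔽₂ = CommutativeRing xor-∧-commutativeRing

    ⟦_⟧₂ : Bool → Carrier
    ⟦ true ⟧₂  = 1#
    ⟦ false ⟧₂ = 0#

    𝔽₂⟶K : 𝔽₂.rawRing -Raw-AlmostCommutative⟶ fromCommutativeSemiring commutativeSemiring
    𝔽₂⟶K = record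
      { ⟦_⟧    = ⟦_⟧₂
      ; +-homo = +-homo
      ; *-homo = *-homo
      ; -‿homo = λ _ → refl
      ; 0-homo = refl
      ; 1-homo = refl
      }
      where
      +-homo : ∀ a b → ⟦ a 𝔽₂.+ b ⟧₂ ≈ ⟦ a ⟧₂ + ⟦ b ⟧₂
      +-homo true  true  = sym char2
      +-homo true  false = sym (+-identityʳ 1#)
      +-homo false true  = sym (+-identityˡ 1#)
      +-homo false false = sym (+-identityˡ 0#)
      *-homo : ∀ a b → ⟦ a 𝔽₂.* b ⟧₂ ≈ ⟦ a ⟧₂ * ⟦ b ⟧₂
      *-homo true  true  = sym (*-identityˡ 1#)
      *-homo true  false = sym (*-identityˡ 0#)
      *-homo false true  = sym (zeroˡ 1#)
      *-homo false false = sym (zeroˡ 0#)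

    ≟₂ : ∀ a b → Maybe (⟦ a ⟧₂ ≈ ⟦ b ⟧₂)
    ≟₂ true  true  = just refl
    ≟₂ false false = just refl
    ≟₂ _     _     = nothing

  open import Algebra.Solver.Ring 𝔽₂.rawRing (fromCommutativeSemiring commutativeSemiring) 𝔽₂⟶K ≟₂
    using (solve; _:=_; _:+_; _:*_; con)

  ≈⇒+≈0 : ∀ {x y} → x ≈ y → x + y ≈ 0#
  ≈⇒+≈0 {x} x≈y = trans (+-congˡ (sym x≈y)) (x+x≈0 x)

  +≈0⇒≈ : ∀ {x y} → x + y ≈ 0# → x ≈ y
  +≈0⇒≈ {x} {y} x+y≈0 = begin
    x            ≈⟨ solve 2 (λ x y → x := (x :+ y) :+ y) refl x y ⟩
    (x + y) + y  ≈⟨ +-congʳ x+y≈0 ⟩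
    0# + y       ≈⟨ +-identityˡ y ⟩
    y            ∎

  +≈0⇔≈ : ∀ {x y} → x + y ≈ 0# ⇔ x ≈ y
  +≈0⇔≈ = mk⇔ +≈0⇒≈ ≈⇒+≈0

  ⁻¹-inverseˡ : ∀ {x} → ¬ x ≈ 0# → x ⁻¹ * x ≈ 1#
  ⁻¹-inverseˡ {x} x≉0 = trans (*-comm _ _) (inverseʳ x x≉0)

  *-cancelˡ : ∀ {k x y} → ¬ k ≈ 0# → k * x ≈ k * y → x ≈ y
  *-cancelˡ {k} {x} {y} k≉0 kx≈ky = begin
    x               ≈⟨ *-identityˡ x ⟨
    1# * x          ≈⟨ *-congʳ (⁻¹-inverseˡ k≉0) ⟨
    (k ⁻¹ * k) * x  ≈⟨ *-assoc _ _ _ ⟩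
    k ⁻¹ * (k * x)  ≈⟨ *-congˡ kx≈ky ⟩
    k ⁻¹ * (k * y)  ≈⟨ *-assoc _ _ _ ⟨
    (k ⁻¹ * k) * y  ≈⟨ *-congʳ (⁻¹-inverseˡ k≉0) ⟩
    1# * y          ≈⟨ *-identityˡ y ⟩
    y               ∎

  *-cancelʳ : ∀ {k x y} → ¬ k ≈ 0# → x * k ≈ y * k → x ≈ y
  *-cancelʳ k≉0 xk≈yk = *-cancelˡ k≉0 (trans (*-comm _ _) (trans xk≈yk (*-comm _ _)))

  *≈0⇒≈0 : ∀ {k x} → ¬ k ≈ 0# → k * x ≈ 0# → x ≈ 0#
  *≈0⇒≈0 {k} k≉0 kx≈0 = *-cancelˡ k≉0 (trans kx≈0 (sym (zeroʳ k)))

  *-≉0 : ∀ {x y} → ¬ x ≈ 0# → ¬ y ≈ 0# → ¬ x * y ≈ 0#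
  *-≉0 x≉0 y≉0 xy≈0 = y≉0 (*≈0⇒≈0 x≉0 xy≈0)

  *≈1⇒≉0 : ∀ {x y} → x * y ≈ 1# → ¬ x ≈ 0#
  *≈1⇒≉0 {x} {y} xy≈1 x≈0 = 1≉0 (begin
    1#      ≈⟨ xy≈1 ⟨
    x * y   ≈⟨ *-congʳ x≈0 ⟩
    0# * y  ≈⟨ zeroˡ y ⟩
    0#      ∎)

  proportional⇒≈0⇔≈0 : ∀ {α β x y} → ¬ α ≈ 0# → ¬ β ≈ 0# → α * x ≈ β * y → x ≈ 0# ⇔ y ≈ 0#
  proportional⇒≈0⇔≈0 {α} {β} α≉0 β≉0 αx≈βy = mk⇔
    (λ x≈0 → *≈0⇒≈0 β≉0 (trans (sym αx≈βy) (trans (*-congˡ x≈0) (zeroʳ α))))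
    (λ y≈0 → *≈0⇒≈0 α≉0 (trans αx≈βy (trans (*-congˡ y≈0) (zeroʳ β))))

  ⁻¹*≈⇔≈* : ∀ {c x y} → ¬ c ≈ 0# → c ⁻¹ * x ≈ y ⇔ x ≈ c * y
  ⁻¹*≈⇔≈* {c} {x} {y} c≉0 = mk⇔
    (λ c⁻¹x≈y → trans (sym c[c⁻¹x]≈x) (*-congˡ c⁻¹x≈y))
    (λ x≈cy → *-cancelˡ c≉0 (trans c[c⁻¹x]≈x x≈cy))
    where
    c[c⁻¹x]≈x : c * (c ⁻¹ * x) ≈ x
    c[c⁻¹x]≈x = trans (sym (*-assoc c (c ⁻¹) x)) (trans (*-congʳ (inverseʳ c c≉0)) (*-identityˡ x))

  module _ where
    open Exp commutativeSemiring renaming (_^_ to _^ᴷ_)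
      using (^-congˡ; ^-homo-*; ^-assocʳ; ^-distrib-*)

    pow≡^ : ∀ x n → pow x n ≡ x ^ᴷ n
    pow≡^ x zero    = ≡-refl
    pow≡^ x (suc n) = ≡-cong (x *_) (pow≡^ x n)

    pow-congˡ : ∀ {x y} n → x ≈ y → pow x n ≈ pow y n
    pow-congˡ {x} {y} n x≈y rewrite pow≡^ x n | pow≡^ y n = ^-congˡ n x≈y

    pow-homo-* : ∀ x m n → pow x (m +ℕ n) ≈ pow x m * pow x n
    pow-homo-* x m n rewrite pow≡^ x (m +ℕ n) | pow≡^ x m | pow≡^ x n = ^-homo-* x m n

    pow-assocʳ : ∀ x m n → pow (pow x m) n ≈ pow x (m *ℕ n)
    pow-assocʳ x m n rewrite pow≡^ x m | pow≡^ (x ^ᴷ m) n | pow≡^ x (m *ℕ n) = ^-assocʳ x m n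

    pow-distrib-* : ∀ x y n → pow (x * y) n ≈ pow x n * pow y n
    pow-distrib-* x y n rewrite pow≡^ (x * y) n | pow≡^ x n | pow≡^ y n = ^-distrib-* x y n

  pow-1# : ∀ n → pow 1# n ≈ 1#
  pow-1# zero    = refl
  pow-1# (suc n) = trans (*-identityˡ _) (pow-1# n)

  pow-0# : ∀ n → pow 0# (suc n) ≈ 0#
  pow-0# n = zeroˡ _

  pow-≉0 : ∀ {x} n → ¬ x ≈ 0# → ¬ pow x n ≈ 0#
  pow-≉0 zero    x≉0 = 1≉0
  pow-≉0 (suc n) x≉0 = *-≉0 x≉0 (pow-≉0 n x≉0)

  pow-⁻¹ : ∀ {x} n → ¬ x ≈ 0# → pow (x ⁻¹) n * pow x n ≈ 1#
  pow-⁻¹ {x} n x≉0 = begin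
    pow (x ⁻¹) n * pow x n  ≈⟨ pow-distrib-* (x ⁻¹) x n ⟨
    pow (x ⁻¹ * x) n        ≈⟨ pow-congˡ n (⁻¹-inverseˡ x≉0) ⟩
    pow 1# n                ≈⟨ pow-1# n ⟩
    1#                      ∎

  *-pow-pred : ∀ x n .{{_ : NonZero n}} → x * pow x (n ∸ 1) ≈ pow x n
  *-pow-pred x (suc n) = refl

  pow-2* : ∀ x m → pow x (2 *ℕ m) ≈ pow x m * pow x m
  pow-2* x m = trans (pow-homo-* x m (m +ℕ 0)) (*-congˡ (reflexive (≡-cong (pow x) (ℕ.+-identityʳ m))))

  pow-2^suc : ∀ x k → pow x (2 ^ suc k) ≈ pow (x * x) (2 ^ k)
  pow-2^suc x k = begin
    pow x (2 ^ suc k)      ≈⟨ pow-assocʳ x 2 (2 ^ k) ⟨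
    pow (pow x 2) (2 ^ k)  ≈⟨ pow-congˡ (2 ^ k) (*-congˡ (*-identityʳ x)) ⟩
    pow (x * x) (2 ^ k)    ∎

  frobenius : ∀ k x y → pow (x + y) (2 ^ k) ≈ pow x (2 ^ k) + pow y (2 ^ k)
  frobenius zero    x y = solve 2 (λ x y → (x :+ y) :* con true := x :* con true :+ y :* con true) refl x y
  frobenius (suc k) x y = begin
    pow (x + y) (2 ^ suc k)                    ≈⟨ pow-2^suc (x + y) k ⟩
    pow ((x + y) * (x + y)) (2 ^ k)            ≈⟨ pow-congˡ (2 ^ k) (solve 2 (λ x y →
                                                    (x :+ y) :* (x :+ y) := x :* x :+ y :* y) refl x y) ⟩
    pow (x * x + y * y) (2 ^ k)                ≈⟨ frobenius k (x * x) (y * y) ⟩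
    pow (x * x) (2 ^ k) + pow (y * y) (2 ^ k)  ≈⟨ +-cong (pow-2^suc x k) (pow-2^suc y k) ⟨
    pow x (2 ^ suc k) + pow y (2 ^ suc k)      ∎

  frobenius-1# : ∀ k x → pow (x + 1#) (2 ^ k) ≈ pow x (2 ^ k) + 1#
  frobenius-1# k x = trans (frobenius k x 1#) (+-congˡ (pow-1# (2 ^ k)))

  idempotent⇒pow-2^≈ : ∀ {p} k → p * p ≈ p → pow p (2 ^ k) ≈ p
  idempotent⇒pow-2^≈ {p} zero    pp≈p = *-identityʳ p
  idempotent⇒pow-2^≈ {p} (suc k) pp≈p = begin
    pow p (2 ^ suc k)    ≈⟨ pow-2^suc p k ⟩
    pow (p * p) (2 ^ k)  ≈⟨ pow-congˡ (2 ^ k) pp≈p ⟩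
    pow p (2 ^ k)        ≈⟨ idempotent⇒pow-2^≈ k pp≈p ⟩
    p                    ∎

  complementary⇒idempotent : ∀ {p s} → p + s ≈ 1# → p * s ≈ 0# → p * p ≈ p × s * s ≈ s
  complementary⇒idempotent {p} {s} p+s≈1 ps≈0 = +≈0⇒≈ p²+p≈0 , +≈0⇒≈ s²+s≈0
    where
    p²+p≈0 : p * p + p ≈ 0#
    p²+p≈0 = begin
      p * p + p                 ≈⟨ solve 2 (λ p s → p :* p :+ p := p :* (p :+ s :+ con true) :+ p :* s) refl p s ⟩
      p * (p + s + 1#) + p * s  ≈⟨ +-cong (*-congˡ (≈⇒+≈0 p+s≈1)) ps≈0 ⟩
      p * 0# + 0#               ≈⟨ trans (+-identityʳ _) (zeroʳ p) ⟩
      0#                        ∎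
    s²+s≈0 : s * s + s ≈ 0#
    s²+s≈0 = begin
      s * s + s                 ≈⟨ solve 2 (λ p s → s :* s :+ s := s :* (p :+ s :+ con true) :+ p :* s) refl p s ⟩
      s * (p + s + 1#) + p * s  ≈⟨ +-cong (*-congˡ (≈⇒+≈0 p+s≈1)) ps≈0 ⟩
      s * 0# + 0#               ≈⟨ trans (+-identityʳ _) (zeroʳ s) ⟩
      0#                        ∎

  module IdempotentSplitting {p s : Carrier} (pp≈p : p * p ≈ p) (ss≈s : s * s ≈ s) (ps≈0 : p * s ≈ 0#) where

    split-* : ∀ x y x′ y′ → (p * x + s * y) * (p * x′ + s * y′) ≈ p * (x * x′) + s * (y * y′)
    split-* x y x′ y′ = begin
      (p * x + s * y) * (p * x′ + s * y′)
        ≈⟨ solve 6 (λ p s x y x′ y′ → (p :* x :+ s :* y) :* (p :* x′ :+ s :* y′)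
             := p :* p :* (x :* x′) :+ p :* s :* (x :* y′ :+ y :* x′) :+ s :* s :* (y :* y′))
             refl p s x y x′ y′ ⟩
      p * p * (x * x′) + p * s * (x * y′ + y * x′) + s * s * (y * y′)
        ≈⟨ +-cong (+-cong (*-congʳ pp≈p) (trans (*-congʳ ps≈0) (zeroˡ _))) (*-congʳ ss≈s) ⟩
      p * (x * x′) + 0# + s * (y * y′)
        ≈⟨ +-congʳ (+-identityʳ _) ⟩
      p * (x * x′) + s * (y * y′) ∎

    split-frobenius : ∀ k x y → pow (p * x + s * y) (2 ^ k) ≈ p * pow x (2 ^ k) + s * pow y (2 ^ k)
    split-frobenius k x y = begin
      pow (p * x + s * y) (2 ^ k)
        ≈⟨ frobenius k (p * x) (s * y) ⟩
      pow (p * x) (2 ^ k) + pow (s * y) (2 ^ k)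
        ≈⟨ +-cong (pow-distrib-* p x (2 ^ k)) (pow-distrib-* s y (2 ^ k)) ⟩
      pow p (2 ^ k) * pow x (2 ^ k) + pow s (2 ^ k) * pow y (2 ^ k)
        ≈⟨ +-cong (*-congʳ (idempotent⇒pow-2^≈ k pp≈p)) (*-congʳ (idempotent⇒pow-2^≈ k ss≈s)) ⟩
      p * pow x (2 ^ k) + s * pow y (2 ^ k) ∎

  Tr : ℕ → Carrier → Carrier
  Tr zero    x = 0#
  Tr (suc i) x = Tr i x + pow x (2 ^ i)

  *-T≈Tr : ∀ k x → x * T k x ≈ Tr k x
  *-T≈Tr zero    x = zeroʳ x
  *-T≈Tr (suc k) x = begin
    x * (T k x + pow x (2 ^ k ∸ 1))    ≈⟨ distribˡ x _ _ ⟩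
    x * T k x + x * pow x (2 ^ k ∸ 1)  ≈⟨ +-cong (*-T≈Tr k x) (*-pow-pred x (2 ^ k) {{ℕ.m^n≢0 2 k}}) ⟩
    Tr k x + pow x (2 ^ k)             ∎

  Tr-congʳ : ∀ k {x y} → x ≈ y → Tr k x ≈ Tr k y
  Tr-congʳ zero    x≈y = refl
  Tr-congʳ (suc k) x≈y = +-cong (Tr-congʳ k x≈y) (pow-congˡ (2 ^ k) x≈y)

  Tr-+ : ∀ k x y → Tr k (x + y) ≈ Tr k x + Tr k y
  Tr-+ zero    x y = sym (+-identityʳ 0#)
  Tr-+ (suc k) x y = begin
    Tr k (x + y) + pow (x + y) (2 ^ k)
      ≈⟨ +-cong (Tr-+ k x y) (frobenius k x y) ⟩
    (Tr k x + Tr k y) + (pow x (2 ^ k) + pow y (2 ^ k))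
      ≈⟨ solve 4 (λ a b c d → (a :+ b) :+ (c :+ d) := (a :+ c) :+ (b :+ d)) refl _ _ _ _ ⟩
    (Tr k x + pow x (2 ^ k)) + (Tr k y + pow y (2 ^ k)) ∎

  Tr-0# : ∀ k → Tr k 0# ≈ 0#
  Tr-0# k = begin
    Tr k 0#            ≈⟨ Tr-congʳ k (+-identityʳ 0#) ⟨
    Tr k (0# + 0#)     ≈⟨ Tr-+ k 0# 0# ⟩
    Tr k 0# + Tr k 0#  ≈⟨ x+x≈0 (Tr k 0#) ⟩
    0#                 ∎

  Tr-square : ∀ k x → Tr k (x * x) ≈ Tr k x * Tr k x
  Tr-square zero    x = sym (zeroˡ 0#)
  Tr-square (suc k) x = begin
    Tr k (x * x) + pow (x * x) (2 ^ k)  ≈⟨ +-cong (Tr-square k x) (pow-distrib-* x x (2 ^ k)) ⟩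
    S * S + P * P                       ≈⟨ solve 2 (λ s p → s :* s :+ p :* p := (s :+ p) :* (s :+ p)) refl S P ⟩
    (S + P) * (S + P)                   ∎
    where
    S P : Carrier
    S = Tr k x
    P = pow x (2 ^ k)

  Tr²≈Tr+x+x^2^k : ∀ k x → Tr k x * Tr k x ≈ Tr k x + x + pow x (2 ^ k)
  Tr²≈Tr+x+x^2^k zero    x = solve 1 (λ x → con false :* con false := con false :+ x :+ x :* con true) refl x
  Tr²≈Tr+x+x^2^k (suc k) x = begin
    (S + P) * (S + P)
      ≈⟨ solve 2 (λ s p → (s :+ p) :* (s :+ p) := s :* s :+ p :* p) refl S P ⟩
    S * S + P * P
      ≈⟨ +-cong (Tr²≈Tr+x+x^2^k k x) (sym (trans (pow-2^suc x k) (pow-distrib-* x x (2 ^ k)))) ⟩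
    (S + x + P) + pow x (2 ^ suc k)
      ≈⟨ solve 4 (λ s x p r → (s :+ x :+ p) :+ r := (s :+ p) :+ x :+ r) refl S x P _ ⟩
    (S + P) + x + pow x (2 ^ suc k) ∎
    where
    S P : Carrier
    S = Tr k x
    P = pow x (2 ^ k)

  Tr-telescopes : ∀ k x → Tr k (x + x * x) ≈ x + pow x (2 ^ k)
  Tr-telescopes k x = begin
    Tr k (x + x * x)                       ≈⟨ Tr-+ k x (x * x) ⟩
    Tr k x + Tr k (x * x)                  ≈⟨ +-congˡ (trans (Tr-square k x) (Tr²≈Tr+x+x^2^k k x)) ⟩
    Tr k x + (Tr k x + x + pow x (2 ^ k))  ≈⟨ solve 3 (λ l x p → l :+ (l :+ x :+ p) := x :+ p)
                                                refl (Tr k x) x (pow x (2 ^ k)) ⟩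
    x + pow x (2 ^ k)                      ∎

  -- ⟨ b ⟩≃ z is ⟨ b ⟩ ≈ z with the denominator cleared.
  ⟨_⟩≃_ : Carrier → Carrier → Set ℓ
  ⟨ b ⟩≃ z = b * z ≈ b * b + 1#

  ⟨⟩≃⇒≉0 : ∀ {b z} → ⟨ b ⟩≃ z → ¬ b ≈ 0#
  ⟨⟩≃⇒≉0 {b} {z} bz≈bb+1 b≈0 = 1≉0 (begin
    1#                                  ≈⟨ solve 2 (λ b z → con true
                                              := b :* z :+ (b :* b :+ con true) :+ b :* (z :+ b)) refl b z ⟩
    b * z + (b * b + 1#) + b * (z + b)  ≈⟨ +-cong (≈⇒+≈0 bz≈bb+1) (trans (*-congʳ b≈0) (zeroˡ _)) ⟩
    0# + 0#                             ≈⟨ +-identityʳ 0# ⟩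
    0#                                  ∎)

  ⟨⟩-≃ : ∀ {b} → ¬ b ≈ 0# → ⟨ b ⟩≃ ⟨ b ⟩
  ⟨⟩-≃ {b} b≉0 = trans (distribˡ b b (b ⁻¹)) (+-congˡ (inverseʳ b b≉0))

  ⟨⟩≃⇒≈⟨⟩ : ∀ {b z} → ⟨ b ⟩≃ z → z ≈ ⟨ b ⟩
  ⟨⟩≃⇒≈⟨⟩ ⟨b⟩≃z = *-cancelˡ b≉0 (trans ⟨b⟩≃z (sym (⟨⟩-≃ b≉0)))
    where b≉0 = ⟨⟩≃⇒≉0 ⟨b⟩≃z

  ⟨⟩-cong : ∀ {x y} → x ≈ y → ⟨ x ⟩ ≈ ⟨ y ⟩
  ⟨⟩-cong x≈y = +-cong x≈y (⁻¹-cong x≈y)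

  ⟨⟩≃-frobenius : ∀ k {b z} → ⟨ b ⟩≃ z → ⟨ pow b (2 ^ k) ⟩≃ pow z (2 ^ k)
  ⟨⟩≃-frobenius k {b} {z} bz≈bb+1 = begin
    pow b (2 ^ k) * pow z (2 ^ k)       ≈⟨ pow-distrib-* b z (2 ^ k) ⟨
    pow (b * z) (2 ^ k)                 ≈⟨ pow-congˡ (2 ^ k) bz≈bb+1 ⟩
    pow (b * b + 1#) (2 ^ k)            ≈⟨ frobenius-1# k (b * b) ⟩
    pow (b * b) (2 ^ k) + 1#            ≈⟨ +-congʳ (pow-distrib-* b b (2 ^ k)) ⟩
    pow b (2 ^ k) * pow b (2 ^ k) + 1#  ∎

  ⟨⟩-surjective : IsAlgClosed K → ∀ z → ∃ λ b → ⟨ b ⟩≃ z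
  ⟨⟩-surjective closed z with closed 1# (z ∷ [])
  ... | b , b²+zb+1≈0 = b , +≈0⇒≈ (begin
    b * z + (b * b + 1#)       ≈⟨ solve 2 (λ b z → b :* z :+ (b :* b :+ con true)
                                    := b :* (b :* con true) :+ (con true :+ b :* (z :+ b :* con false))) refl b z ⟩
    evalMonic (1# ∷ z ∷ []) b  ≈⟨ b²+zb+1≈0 ⟩
    0#                         ∎)

  pow-2*-inverse : ∀ m {z t} → z * z * t ≈ 1# → pow z (2 *ℕ m) * pow t m ≈ 1#
  pow-2*-inverse m {z} {t} zzt≈1 = begin
    pow z (2 *ℕ m) * pow t m  ≈⟨ *-congʳ (trans (pow-2* z m) (sym (pow-distrib-* z z m))) ⟩
    pow (z * z) m * pow t m   ≈⟨ pow-distrib-* (z * z) t m ⟨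
    pow (z * z * t) m         ≈⟨ pow-congˡ m zzt≈1 ⟩
    pow 1# m                  ≈⟨ pow-1# m ⟩
    1#                        ∎

  inverse-square-root : ∀ m .{{_ : NonZero m}} {t y} → ¬ t ≈ 0# → y * y * pow t (2 *ℕ m) ≈ t →
                        let z = y * pow t (m ∸ 1) in z * z * t ≈ 1# × z * y ≈ pow z (2 *ℕ m)
  inverse-square-root (suc j) {t} {y} t≉0 y²t²ᵐ≈t =
    zzt≈1 , *-cancelʳ (pow-≉0 m t≉0) (trans zytᵐ≈1 (sym (pow-2*-inverse m zzt≈1)))
    where
    m : ℕ
    m = suc j
    z : Carrier
    z = y * pow t j
    y²tᵐtᵐ≈t : y * y * (pow t m * pow t m) ≈ t
    y²tᵐtᵐ≈t = trans (*-congˡ (sym (pow-2* t m))) y²t²ᵐ≈t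
    zzt≈1 : z * z * t ≈ 1#
    zzt≈1 = *-cancelˡ t≉0 (begin
      t * (z * z * t)              ≈⟨ solve 3 (λ t y p → t :* (y :* p :* (y :* p) :* t)
                                        := y :* y :* ((t :* p) :* (t :* p))) refl t y (pow t j) ⟩
      y * y * (pow t m * pow t m)  ≈⟨ y²tᵐtᵐ≈t ⟩
      t                            ≈⟨ *-identityʳ t ⟨
      t * 1#                       ∎)
    zytᵐ≈1 : z * y * pow t m ≈ 1#
    zytᵐ≈1 = *-cancelˡ t≉0 (begin
      t * (z * y * pow t m)        ≈⟨ solve 3 (λ t y p → t :* (y :* p :* y :* (t :* p))
                                        := y :* y :* ((t :* p) :* (t :* p))) refl t y (pow t j) ⟩
      y * y * (pow t m * pow t m)  ≈⟨ y²tᵐtᵐ≈t ⟩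
      t                            ≈⟨ *-identityʳ t ⟨
      t * 1#                       ∎)

  module Setting (k : ℕ) {e : Carrier} (e≉0 : ¬ e ≈ 0#) where

    q : ℕ
    q = 2 ^ suc k

    instance
      q≢0 : NonZero q
      q≢0 = ℕ.m^n≢0 2 (suc k)

    L : Carrier
    L = Tr (suc k) e

    t : Carrier → Carrier
    t y = e * y * (e * y) + e * y + e * e

    Q : Carrier → Carrier
    Q y = pow (e * y) q * y + L * L * y + e

    t-cong : ∀ {y y′} → y ≈ y′ → t y ≈ t y′
    t-cong y≈y′ = +-congʳ (+-cong (*-cong (*-congˡ y≈y′) (*-congˡ y≈y′)) (*-congˡ y≈y′))

    Q-cong : ∀ {y y′} → y ≈ y′ → Q y ≈ Q y′
    Q-cong y≈y′ = +-congʳ (+-cong (*-cong (pow-congˡ q (*-congˡ y≈y′)) y≈y′) (*-congˡ y≈y′))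

    -- e≃⟨ V ⟩⁻¹ is e ≈ ⟨ V ⟩⁻¹ with the denominator cleared.
    e≃⟨_⟩⁻¹ : Carrier → Set ℓ
    e≃⟨ V ⟩⁻¹ = e * (V * V + 1#) ≈ V

    e≃⟨⟩⁻¹-cong : ∀ {V V′} → V ≈ V′ → e≃⟨ V ⟩⁻¹ → e≃⟨ V′ ⟩⁻¹
    e≃⟨⟩⁻¹-cong V≈V′ e≃⟨V⟩⁻¹ =
      trans (*-congˡ (+-congʳ (*-cong (sym V≈V′) (sym V≈V′)))) (trans e≃⟨V⟩⁻¹ V≈V′)

    -- V ≉ 0, since the junk value 0⁻¹ ≈ 0 would force e⁻¹ ≈ 0.
    ⟨⟩≈e⁻¹⇒e≃⟨⟩⁻¹ : ∀ {V} → ⟨ V ⟩ ≈ e ⁻¹ → e≃⟨ V ⟩⁻¹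
    ⟨⟩≈e⁻¹⇒e≃⟨⟩⁻¹ {V} ⟨V⟩≈e⁻¹ = begin
      e * (V * V + 1#)  ≈⟨ *-congˡ (⟨⟩-≃ V≉0) ⟨
      e * (V * ⟨ V ⟩)   ≈⟨ *-congˡ (*-congˡ ⟨V⟩≈e⁻¹) ⟩
      e * (V * e ⁻¹)    ≈⟨ solve 3 (λ e v i → e :* (v :* i) := v :* (e :* i)) refl e V (e ⁻¹) ⟩
      V * (e * e ⁻¹)    ≈⟨ *-congˡ (inverseʳ e e≉0) ⟩
      V * 1#            ≈⟨ *-identityʳ V ⟩
      V                 ∎
      where
      V≉0 : ¬ V ≈ 0#
      V≉0 V≈0 = 1≉0 (begin
        1#              ≈⟨ inverseʳ e e≉0 ⟨
        e * e ⁻¹        ≈⟨ *-congˡ ⟨V⟩≈e⁻¹ ⟨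
        e * (V + V ⁻¹)  ≈⟨ *-congˡ (+-cong V≈0 (trans (⁻¹-cong V≈0) 0⁻¹≈0)) ⟩
        e * (0# + 0#)   ≈⟨ trans (*-congˡ (+-identityʳ 0#)) (zeroʳ e) ⟩
        0#              ∎)

    Tr-t : ∀ y → Tr (suc k) (t y) ≈ e * y + pow (e * y) q + L * L
    Tr-t y = begin
      Tr (suc k) (ey * ey + ey + e * e)
        ≈⟨ Tr-+ (suc k) _ _ ⟩
      Tr (suc k) (ey * ey + ey) + Tr (suc k) (e * e)
        ≈⟨ +-cong (Tr-+ (suc k) _ _) (Tr-square (suc k) e) ⟩
      Tr (suc k) (ey * ey) + Tr (suc k) ey + L * L
        ≈⟨ +-congʳ (+-congʳ (trans (Tr-square (suc k) ey) (Tr²≈Tr+x+x^2^k (suc k) ey))) ⟩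
      (Tr (suc k) ey + ey + pow ey q) + Tr (suc k) ey + L * L
        ≈⟨ solve 4 (λ l x p m → (l :+ x :+ p) :+ l :+ m := x :+ p :+ m)
             refl (Tr (suc k) ey) ey (pow ey q) (L * L) ⟩
      ey + pow ey q + L * L ∎
      where
      ey : Carrier
      ey = e * y

    e*Q≈ : ∀ y → e * Q y ≈ e * y * (1# + Tr (suc k) (t y)) + t y
    e*Q≈ y = begin
      e * (pow (e * y) q * y + L * L * y + e)
        ≈⟨ solve 4 (λ e y p l → e :* (p :* y :+ l :* y :+ e)
             := e :* y :* (con true :+ (e :* y :+ p :+ l)) :+ (e :* y :* (e :* y) :+ e :* y :+ e :* e))
             refl e y (pow (e * y) q) (L * L) ⟩
      e * y * (1# + (e * y + pow (e * y) q + L * L)) + t y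
        ≈⟨ +-congʳ (*-congˡ (+-congˡ (Tr-t y))) ⟨
      e * y * (1# + Tr (suc k) (t y)) + t y ∎

    -- After substituting b z ≈ b² + 1 and b^q z^q ≈ b^(2q) + 1, V² z² t y is a polynomial in
    -- e, b, b^q that e (V² + 1) ≈ V reduces to V².
    e≃⟨⟩⁻¹⇒zzt≈1 : ∀ {b z y} → ⟨ b ⟩≃ z → z * y ≈ pow z q → e≃⟨ b * pow b q ⟩⁻¹ → z * z * t y ≈ 1#
    e≃⟨⟩⁻¹⇒zzt≈1 {b} {z} {y} ⟨b⟩≃z zy≈zᵠ e≃⟨V⟩⁻¹ = *-cancelˡ (*-≉0 V≉0 V≉0) (begin
      V * V * (z * z * t y)
        ≈⟨ solve 5 (λ e b a z y → b :* a :* (b :* a) :* (z :* z :* (e :* y :* (e :* y) :+ e :* y :+ e :* e))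
             := e :* e :* (b :* b) :* ((a :* (z :* y)) :* (a :* (z :* y)))
                :+ e :* (b :* a) :* ((b :* z) :* (a :* (z :* y)))
                :+ e :* e :* (a :* a) :* ((b :* z) :* (b :* z))) refl e b a z y ⟩
      e * e * (b * b) * (azy * azy) + e * V * (b * z * azy) + e * e * (a * a) * (b * z * (b * z))
        ≈⟨ +-cong (+-cong (*-congˡ (*-cong azy≈ azy≈)) (*-congˡ (*-cong ⟨b⟩≃z azy≈)))
                  (*-congˡ (*-cong ⟨b⟩≃z ⟨b⟩≃z)) ⟩
      e * e * (b * b) * ((a * a + 1#) * (a * a + 1#)) + e * V * ((b * b + 1#) * (a * a + 1#))
        + e * e * (a * a) * ((b * b + 1#) * (b * b + 1#))
        ≈⟨ solve 3 (λ e b a → e :* e :* (b :* b) :* ((a :* a :+ con true) :* (a :* a :+ con true))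
               :+ e :* (b :* a) :* ((b :* b :+ con true) :* (a :* a :+ con true))
               :+ e :* e :* (a :* a) :* ((b :* b :+ con true) :* (b :* b :+ con true))
             := e :* (e :* (b :* a :* (b :* a) :+ con true)) :* (a :* a :+ b :* b)
               :+ e :* (b :* a) :* (b :* a :* (b :* a) :+ a :* a :+ b :* b :+ con true)) refl e b a ⟩
      e * (e * (V * V + 1#)) * (a * a + b * b) + e * V * (V * V + a * a + b * b + 1#)
        ≈⟨ +-congʳ (*-congʳ (*-congˡ e≃⟨V⟩⁻¹)) ⟩
      e * V * (a * a + b * b) + e * V * (V * V + a * a + b * b + 1#)
        ≈⟨ solve 4 (λ e v a b → e :* v :* (a :* a :+ b :* b)
                                 :+ e :* v :* (v :* v :+ a :* a :+ b :* b :+ con true)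
             := v :* (e :* (v :* v :+ con true))) refl e V a b ⟩
      V * (e * (V * V + 1#))
        ≈⟨ *-congˡ e≃⟨V⟩⁻¹ ⟩
      V * V
        ≈⟨ *-identityʳ _ ⟨
      V * V * 1# ∎)
      where
      a V azy : Carrier
      a   = pow b q
      V   = b * a
      azy = a * (z * y)
      V≉0 : ¬ V ≈ 0#
      V≉0 = *-≉0 (⟨⟩≃⇒≉0 ⟨b⟩≃z) (pow-≉0 q (⟨⟩≃⇒≉0 ⟨b⟩≃z))
      azy≈ : azy ≈ a * a + 1#
      azy≈ = trans (*-congˡ zy≈zᵠ) (⟨⟩≃-frobenius (suc k) ⟨b⟩≃z)

    -- With g = (b + 1)⁻¹ one has z⁻¹ ≈ g + g², so the trace of t y ≈ z⁻² telescopes to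
    -- (g + g^q)², and Q y ≈ 0 becomes a condition on b^(q+1) alone.
    module ConjugateRoot {b z y} (⟨b⟩≃z : ⟨ b ⟩≃ z) (zy≈zᵠ : z * y ≈ pow z q) (zzt≈1 : z * z * t y ≈ 1#) where

      a V b₁ a₁ g G r : Carrier
      a  = pow b q
      V  = b * a
      b₁ = b + 1#
      a₁ = a + 1#
      g  = b₁ ⁻¹
      G  = pow g q
      r  = g + g * g

      b≉0 : ¬ b ≈ 0#
      b≉0 = ⟨⟩≃⇒≉0 ⟨b⟩≃z

      a≉0 : ¬ a ≈ 0#
      a≉0 = pow-≉0 q b≉0

      bz≈b₁² : b * z ≈ b₁ * b₁
      bz≈b₁² = trans ⟨b⟩≃z (solve 1 (λ b → b :* b :+ con true := (b :+ con true) :* (b :+ con true)) refl b)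

      b₁²≉0 : ¬ b₁ * b₁ ≈ 0#
      b₁²≉0 b₁²≈0 = 1≉0 (begin
        1#            ≈⟨ zzt≈1 ⟨
        z * z * t y   ≈⟨ *-congʳ (*-congʳ z≈0) ⟩
        0# * z * t y  ≈⟨ trans (*-congʳ (zeroˡ z)) (zeroˡ _) ⟩
        0#            ∎)
        where
        z≈0 : z ≈ 0#
        z≈0 = *≈0⇒≈0 b≉0 (trans bz≈b₁² b₁²≈0)

      b₁≉0 : ¬ b₁ ≈ 0#
      b₁≉0 b₁≈0 = b₁²≉0 (trans (*-congʳ b₁≈0) (zeroˡ b₁))

      gb₁≈1 : g * b₁ ≈ 1#
      gb₁≈1 = ⁻¹-inverseˡ b₁≉0

      Ga₁≈1 : G * a₁ ≈ 1#
      Ga₁≈1 = trans (*-congˡ (sym (frobenius-1# (suc k) b))) (pow-⁻¹ q b₁≉0)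

      rb₁²≈b : r * (b₁ * b₁) ≈ b
      rb₁²≈b = begin
        r * (b₁ * b₁)                    ≈⟨ solve 2 (λ g c → (g :+ g :* g) :* (c :* c)
                                                 := g :* c :* c :+ g :* c :* (g :* c)) refl g b₁ ⟩
        g * b₁ * b₁ + g * b₁ * (g * b₁)  ≈⟨ +-cong (*-congʳ gb₁≈1) (*-cong gb₁≈1 gb₁≈1) ⟩
        1# * b₁ + 1# * 1#                ≈⟨ solve 1 (λ b → con true :* (b :+ con true) :+ con true :* con true := b)
                                                 refl b ⟩
        b                                ∎

      zr≈1 : z * r ≈ 1#
      zr≈1 = *-cancelʳ b₁²≉0 (begin
        z * r * (b₁ * b₁)    ≈⟨ *-assoc z r _ ⟩
        z * (r * (b₁ * b₁))  ≈⟨ *-congˡ rb₁²≈b ⟩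
        z * b                ≈⟨ trans (*-comm z b) bz≈b₁² ⟩
        b₁ * b₁              ≈⟨ *-identityˡ _ ⟨
        1# * (b₁ * b₁)       ∎)

      t≈r² : t y ≈ r * r
      t≈r² = begin
        t y                    ≈⟨ solve 1 (λ t → t := con true :* con true :* t) refl (t y) ⟩
        1# * 1# * t y          ≈⟨ *-congʳ (*-cong zr≈1 zr≈1) ⟨
        z * r * (z * r) * t y  ≈⟨ solve 3 (λ z r t → z :* r :* (z :* r) :* t := z :* z :* t :* (r :* r))
                                      refl z r (t y) ⟩
        z * z * t y * (r * r)  ≈⟨ *-congʳ zzt≈1 ⟩
        1# * (r * r)           ≈⟨ *-identityˡ _ ⟩
        r * r                  ∎

      Tr-t≈ : Tr (suc k) (t y) ≈ (g + G) * (g + G)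
      Tr-t≈ = begin
        Tr (suc k) (t y)             ≈⟨ Tr-congʳ (suc k) t≈r² ⟩
        Tr (suc k) (r * r)           ≈⟨ Tr-square (suc k) r ⟩
        Tr (suc k) r * Tr (suc k) r  ≈⟨ *-cong (Tr-telescopes (suc k) g) (Tr-telescopes (suc k) g) ⟩
        (g + G) * (g + G)            ∎

      ab₁²y≈ba₁² : a * (b₁ * b₁) * y ≈ b * (a₁ * a₁)
      ab₁²y≈ba₁² = begin
        a * (b₁ * b₁) * y  ≈⟨ *-congʳ (*-congˡ bz≈b₁²) ⟨
        a * (b * z) * y    ≈⟨ solve 4 (λ a b z y → a :* (b :* z) :* y := b :* (a :* (z :* y))) refl a b z y ⟩
        b * (a * (z * y))  ≈⟨ *-congˡ (trans (*-congˡ zy≈zᵠ) (⟨⟩≃-frobenius (suc k) ⟨b⟩≃z)) ⟩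
        b * (a * a + 1#)   ≈⟨ *-congˡ (solve 1 (λ a → a :* a :+ con true := (a :+ con true) :* (a :+ con true))
                                 refl a) ⟩
        b * (a₁ * a₁)      ∎

      [1+g+G]b₁a₁≈V+1 : (1# + g + G) * (b₁ * a₁) ≈ V + 1#
      [1+g+G]b₁a₁≈V+1 = begin
        (1# + g + G) * (b₁ * a₁)             ≈⟨ solve 4 (λ g G b₁ a₁ → (con true :+ g :+ G) :* (b₁ :* a₁)
                                                   := b₁ :* a₁ :+ g :* b₁ :* a₁ :+ G :* a₁ :* b₁) refl g G b₁ a₁ ⟩
        b₁ * a₁ + g * b₁ * a₁ + G * a₁ * b₁  ≈⟨ +-cong (+-congˡ (*-congʳ gb₁≈1)) (*-congʳ Ga₁≈1) ⟩
        b₁ * a₁ + 1# * a₁ + 1# * b₁          ≈⟨ solve 2 (λ b a → (b :+ con true) :* (a :+ con true)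
                                                     :+ con true :* (a :+ con true) :+ con true :* (b :+ con true)
                                                   := b :* a :+ con true) refl b a ⟩
        V + 1#                               ∎

      scaled : a * (b₁ * b₁) * (b₁ * b₁) * e * Q y ≈ b * (e * (V * V + 1#) + V)
      scaled = begin
        a * (b₁ * b₁) * (b₁ * b₁) * e * Q y
          ≈⟨ *-assoc _ e (Q y) ⟩
        a * (b₁ * b₁) * (b₁ * b₁) * (e * Q y)
          ≈⟨ *-congˡ (trans (e*Q≈ y) (+-cong (*-congˡ (+-congˡ Tr-t≈)) t≈r²)) ⟩
        a * (b₁ * b₁) * (b₁ * b₁) * (e * y * (1# + (g + G) * (g + G)) + r * r)
          ≈⟨ solve 7 (λ a c y e g G r →
               a :* (c :* c) :* (c :* c) :* (e :* y :* (con true :+ (g :+ G) :* (g :+ G)) :+ r :* r)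
               := e :* (a :* (c :* c) :* y) :* (c :* c) :* ((con true :+ g :+ G) :* (con true :+ g :+ G))
                  :+ a :* (r :* (c :* c)) :* (r :* (c :* c))) refl a b₁ y e g G r ⟩
        e * (a * (b₁ * b₁) * y) * (b₁ * b₁) * ((1# + g + G) * (1# + g + G))
          + a * (r * (b₁ * b₁)) * (r * (b₁ * b₁))
          ≈⟨ +-cong (*-congʳ (*-congʳ (*-congˡ ab₁²y≈ba₁²))) (*-cong (*-congˡ rb₁²≈b) rb₁²≈b) ⟩
        e * (b * (a₁ * a₁)) * (b₁ * b₁) * ((1# + g + G) * (1# + g + G)) + a * b * b
          ≈⟨ solve 6 (λ e b a₁ b₁ x a → e :* (b :* (a₁ :* a₁)) :* (b₁ :* b₁) :* (x :* x) :+ a :* b :* b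
               := e :* b :* ((x :* (b₁ :* a₁)) :* (x :* (b₁ :* a₁))) :+ b :* (b :* a))
               refl e b a₁ b₁ (1# + g + G) a ⟩
        e * b * (((1# + g + G) * (b₁ * a₁)) * ((1# + g + G) * (b₁ * a₁))) + b * V
          ≈⟨ +-congʳ (*-congˡ (*-cong [1+g+G]b₁a₁≈V+1 [1+g+G]b₁a₁≈V+1)) ⟩
        e * b * ((V + 1#) * (V + 1#)) + b * V
          ≈⟨ solve 3 (λ e b v → e :* b :* ((v :+ con true) :* (v :+ con true)) :+ b :* v
               := b :* (e :* (v :* v :+ con true) :+ v)) refl e b V ⟩
        b * (e * (V * V + 1#) + V) ∎

      Q≈0⇔e≃⟨V⟩⁻¹ : Q y ≈ 0# ⇔ e≃⟨ V ⟩⁻¹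
      Q≈0⇔e≃⟨V⟩⁻¹ =
        +≈0⇔≈ ⇔-∘ proportional⇒≈0⇔≈0 (*-≉0 (*-≉0 (*-≉0 a≉0 b₁²≉0) b₁²≉0) e≉0) b≉0 scaled

    -- κ y is z⁻¹ for every z with z * y ≈ z^q and z² t y ≈ 1, so such z is determined by y.
    κ : Carrier → Carrier
    κ y = y * pow (t y) (2 ^ k)

    κ-cong : ∀ {y y′} → y ≈ y′ → κ y ≈ κ y′
    κ-cong y≈y′ = *-cong y≈y′ (pow-congˡ (2 ^ k) (t-cong y≈y′))

    z*κ≈1 : ∀ {z y} → z * y ≈ pow z q → z * z * t y ≈ 1# → z * κ y ≈ 1#
    z*κ≈1 {z} {y} zy≈zᵠ zzt≈1 =
      trans (sym (*-assoc z y _)) (trans (*-congʳ zy≈zᵠ) (pow-2*-inverse (2 ^ k) zzt≈1))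

    Q-0# : Q 0# ≈ e
    Q-0# = solve 3 (λ p l e → p :* con false :+ l :* con false :+ e := e) refl (pow (e * 0#) q) (L * L) e

    Q≈0⇒≉0 : ∀ {y} → Q y ≈ 0# → ¬ y ≈ 0#
    Q≈0⇒≉0 Qy≈0 y≈0 = e≉0 (trans (sym Q-0#) (trans (Q-cong (sym y≈0)) Qy≈0))

    Q≈0⇒trace-condition : ∀ {y} → Q y ≈ 0# → e * y * (1# + Tr (suc k) (t y)) ≈ t y
    Q≈0⇒trace-condition {y} Qy≈0 = +≈0⇒≈ (trans (sym (e*Q≈ y)) (trans (*-congˡ Qy≈0) (zeroʳ e)))

    Q≈0⇒t≉0 : ∀ {y} → Q y ≈ 0# → ¬ t y ≈ 0#
    Q≈0⇒t≉0 {y} Qy≈0 t≈0 = *-≉0 e≉0 (Q≈0⇒≉0 Qy≈0) (begin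
      e * y                            ≈⟨ *-identityʳ _ ⟨
      e * y * 1#                       ≈⟨ *-congˡ (trans (+-congˡ Tr-t≈0) (+-identityʳ 1#)) ⟨
      e * y * (1# + Tr (suc k) (t y))  ≈⟨ Q≈0⇒trace-condition Qy≈0 ⟩
      t y                              ≈⟨ t≈0 ⟩
      0#                               ∎)
      where
      Tr-t≈0 : Tr (suc k) (t y) ≈ 0#
      Tr-t≈0 = trans (Tr-congʳ (suc k) t≈0) (Tr-0# (suc k))

    Q≈0⇒y²tᵠ≈t : ∀ {y} → Q y ≈ 0# → y * y * pow (t y) q ≈ t y
    Q≈0⇒y²tᵠ≈t {y} Qy≈0 = *-cancelˡ (*-≉0 e≉0 e≉0) (begin
      e * e * (y * y * pow (t y) q)
        ≈⟨ *-congˡ (*-congˡ tᵠ≈X²+X+t) ⟩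
      e * e * (y * y * (X * X + X + t y))
        ≈⟨ solve 4 (λ e y x t → e :* e :* (y :* y :* (x :* x :+ x :+ t))
             := e :* y :* (con true :+ x) :* (e :* y :* (con true :+ x)) :+ e :* y :* (e :* y :* (con true :+ x))
                :+ e :* y :* (e :* y) :* t) refl e y X (t y) ⟩
      D * D + e * y * D + e * y * (e * y) * t y
        ≈⟨ +-congʳ (+-cong (*-cong D≈t D≈t) (*-congˡ D≈t)) ⟩
      t y * t y + e * y * t y + e * y * (e * y) * t y
        ≈⟨ solve 3 (λ e y t → t :* (e :* y :* (e :* y) :+ e :* y :+ e :* e)
                                 :+ e :* y :* t :+ e :* y :* (e :* y) :* t
             := e :* e :* t) refl e y (t y) ⟩
      e * e * t y ∎)
      where
      X D : Carrier
      X = Tr (suc k) (t y)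
      D = e * y * (1# + X)
      D≈t : D ≈ t y
      D≈t = Q≈0⇒trace-condition Qy≈0
      tᵠ≈X²+X+t : pow (t y) q ≈ X * X + X + t y
      tᵠ≈X²+X+t = +≈0⇒≈ (begin
        pow (t y) q + (X * X + X + t y)  ≈⟨ solve 3 (λ p x t → p :+ (x :* x :+ x :+ t) := x :* x :+ (x :+ t :+ p))
                                              refl (pow (t y) q) X (t y) ⟩
        X * X + (X + t y + pow (t y) q)  ≈⟨ ≈⇒+≈0 (Tr²≈Tr+x+x^2^k (suc k) (t y)) ⟩
        0#                               ∎)

    Q-root⇒conjugate : IsAlgClosed K → ∀ {y} → Q y ≈ 0# →
                       ∃ λ b → ¬ b ≈ 0# × e≃⟨ b * pow b q ⟩⁻¹ × y ≈ pow ⟨ b ⟩ (q ∸ 1)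
    Q-root⇒conjugate closed {y} Qy≈0 =
      b , ⟨⟩≃⇒≉0 ⟨b⟩≃z , Equivalence.to (ConjugateRoot.Q≈0⇔e≃⟨V⟩⁻¹ ⟨b⟩≃z zy≈zᵠ zzt≈1) Qy≈0 , y≈zᵠ⁻¹
      where
      z : Carrier
      z = y * pow (t y) (2 ^ k ∸ 1)
      z-facts : z * z * t y ≈ 1# × z * y ≈ pow z q
      z-facts = inverse-square-root (2 ^ k) {{ℕ.m^n≢0 2 k}} (Q≈0⇒t≉0 Qy≈0) (Q≈0⇒y²tᵠ≈t Qy≈0)
      zzt≈1 : z * z * t y ≈ 1#
      zzt≈1 = proj₁ z-facts
      zy≈zᵠ : z * y ≈ pow z q
      zy≈zᵠ = proj₂ z-facts
      b : Carrier
      b = proj₁ (⟨⟩-surjective closed z)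
      ⟨b⟩≃z : ⟨ b ⟩≃ z
      ⟨b⟩≃z = proj₂ (⟨⟩-surjective closed z)
      z≉0 : ¬ z ≈ 0#
      z≉0 = *≈1⇒≉0 (trans (sym (*-assoc z z (t y))) zzt≈1)
      y≈zᵠ⁻¹ : y ≈ pow ⟨ b ⟩ (q ∸ 1)
      y≈zᵠ⁻¹ = trans (*-cancelˡ z≉0 (trans zy≈zᵠ (sym (*-pow-pred z q))))
                     (pow-congˡ (q ∸ 1) (⟨⟩≃⇒≈⟨⟩ ⟨b⟩≃z))

    module Conjugates {U : Carrier} (e≃⟨U⟩⁻¹ : e≃⟨ U ⟩⁻¹) where

      U≉0 : ¬ U ≈ 0#
      U≉0 U≈0 = e≉0 (begin
        e                   ≈⟨ solve 1 (λ e → e := e :* (con false :* con false :+ con true)) refl e ⟩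
        e * (0# * 0# + 1#)  ≈⟨ *-congˡ (+-congʳ (*-cong U≈0 U≈0)) ⟨
        e * (U * U + 1#)    ≈⟨ e≃⟨U⟩⁻¹ ⟩
        U                   ≈⟨ U≈0 ⟩
        0#                  ∎)

      conjugate-≉0 : ∀ {w} → w * pow w q ≈ U → ¬ w ≈ 0#
      conjugate-≉0 wwᵠ≈U w≈0 = U≉0 (trans (sym wwᵠ≈U) (trans (*-congʳ w≈0) (zeroˡ _)))

      ρ : Carrier → Carrier
      ρ z = e * (pow z q + U * z)

      ρ-cong : ∀ {z z′} → z ≈ z′ → ρ z ≈ ρ z′
      ρ-cong z≈z′ = *-congˡ (+-cong (pow-congˡ q z≈z′) (*-congˡ z≈z′))

      ρ-⟨⟩ : ∀ {w z} → ⟨ w ⟩≃ z → w * pow w q ≈ U → ρ z ≈ w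
      ρ-⟨⟩ {w} {z} ⟨w⟩≃z wa≈U = *-cancelˡ U≉0 (begin
        U * ρ z
          ≈⟨ *-cong (sym wa≈U) (*-congˡ (+-congˡ (*-congʳ (sym wa≈U)))) ⟩
        w * a * (e * (pow z q + w * a * z))
          ≈⟨ solve 5 (λ e w a z zᵠ → w :* a :* (e :* (zᵠ :+ w :* a :* z))
               := e :* (w :* (a :* zᵠ) :+ a :* a :* w :* (w :* z))) refl e w a z (pow z q) ⟩
        e * (w * (a * pow z q) + a * a * w * (w * z))
          ≈⟨ *-congˡ (+-cong (*-congˡ (⟨⟩≃-frobenius (suc k) ⟨w⟩≃z)) (*-congˡ ⟨w⟩≃z)) ⟩
        e * (w * (a * a + 1#) + a * a * w * (w * w + 1#))
          ≈⟨ solve 3 (λ e w a → e :* (w :* (a :* a :+ con true) :+ a :* a :* w :* (w :* w :+ con true))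
               := w :* (e :* (w :* a :* (w :* a) :+ con true))) refl e w a ⟩
        w * (e * (w * a * (w * a) + 1#))
          ≈⟨ *-congˡ (trans (*-congˡ (+-congʳ (*-cong wa≈U wa≈U))) e≃⟨U⟩⁻¹) ⟩
        w * U
          ≈⟨ *-comm w U ⟩
        U * w ∎)
        where
        a : Carrier
        a = pow w q

      -- p and s are complementary idempotents (the indicators of b^(q+1) ≈ U⁻¹ and of
      -- b^(q+1) ≈ U), so ρ ⟨ b ⟩ ≈ p b⁻¹ + s b is b or b⁻¹ without deciding which.
      module Splitting {b} (b≉0 : ¬ b ≈ 0#) (e≃⟨V⟩⁻¹ : e≃⟨ b * pow b q ⟩⁻¹) where

        b′ a a′ V V′ p s : Carrier
        b′ = b ⁻¹
        a  = pow b q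
        a′ = pow b′ q
        V  = b * a
        V′ = b′ * a′
        p  = e * (V + U)
        s  = e * (V′ + U)

        b′b≈1 : b′ * b ≈ 1#
        b′b≈1 = ⁻¹-inverseˡ b≉0

        V′V≈1 : V′ * V ≈ 1#
        V′V≈1 = begin
          V′ * V             ≈⟨ solve 4 (λ b b′ a a′ → b′ :* a′ :* (b :* a) := b′ :* b :* (a′ :* a))
                                  refl b b′ a a′ ⟩
          b′ * b * (a′ * a)  ≈⟨ *-cong b′b≈1 (pow-⁻¹ q b≉0) ⟩
          1# * 1#            ≈⟨ *-identityˡ 1# ⟩
          1#                 ∎

        e[V+V′]≈1 : e * (V + V′) ≈ 1#
        e[V+V′]≈1 = *-cancelˡ (*-≉0 b≉0 (pow-≉0 q b≉0)) (begin
          V * (e * (V + V′))                    ≈⟨ solve 3 (λ e v v′ → v :* (e :* (v :+ v′))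
                                                      := e :* (v :* v :+ con true) :+ e :* (v′ :* v :+ con true))
                                                      refl e V V′ ⟩
          e * (V * V + 1#) + e * (V′ * V + 1#)  ≈⟨ +-cong e≃⟨V⟩⁻¹ (*-congˡ (≈⇒+≈0 V′V≈1)) ⟩
          V + e * 0#                            ≈⟨ trans (+-congˡ (zeroʳ e)) (+-identityʳ V) ⟩
          V                                     ≈⟨ *-identityʳ V ⟨
          V * 1#                                ∎)

        p+s≈1 : p + s ≈ 1#
        p+s≈1 = trans (solve 4 (λ e v v′ u → e :* (v :+ u) :+ e :* (v′ :+ u) := e :* (v :+ v′)) refl e V V′ U)
                      e[V+V′]≈1

        ps≈0 : p * s ≈ 0#
        ps≈0 = begin
          p * s
            ≈⟨ solve 4 (λ e v v′ u → e :* (v :+ u) :* (e :* (v′ :+ u))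
                 := e :* e :* (v′ :* v :+ con true) :+ e :* (e :* (u :* u :+ con true)) :+ e :* u :* (e :* (v :+ v′)))
                 refl e V V′ U ⟩
          e * e * (V′ * V + 1#) + e * (e * (U * U + 1#)) + e * U * (e * (V + V′))
            ≈⟨ +-cong (+-cong (*-congˡ (≈⇒+≈0 V′V≈1)) (*-congˡ e≃⟨U⟩⁻¹)) (*-congˡ e[V+V′]≈1) ⟩
          e * e * 0# + e * U + e * U * 1#
            ≈⟨ solve 2 (λ e u → e :* e :* con false :+ e :* u :+ e :* u :* con true := con false) refl e U ⟩
          0# ∎

        open IdempotentSplitting (proj₁ (complementary⇒idempotent p+s≈1 ps≈0))
                                 (proj₂ (complementary⇒idempotent p+s≈1 ps≈0)) ps≈0

        ρ⟨b⟩≈pb′+sb : ρ ⟨ b ⟩ ≈ p * b′ + s * b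
        ρ⟨b⟩≈pb′+sb = begin
          e * (pow (b + b′) q + U * (b + b′))
            ≈⟨ *-congˡ (+-congʳ (frobenius (suc k) b b′)) ⟩
          e * (a + a′ + U * (b + b′))
            ≈⟨ solve 5 (λ e a a′ u x → e :* (a :+ a′ :+ u :* x) := e :* (a :* con true :+ a′ :* con true :+ u :* x))
                 refl e a a′ U (b + b′) ⟩
          e * (a * 1# + a′ * 1# + U * (b + b′))
            ≈⟨ *-congˡ (+-congʳ (+-cong (*-congˡ (sym b′b≈1)) (*-congˡ (sym b′b≈1)))) ⟩
          e * (a * (b′ * b) + a′ * (b′ * b) + U * (b + b′))
            ≈⟨ solve 6 (λ e a a′ u b b′ → e :* (a :* (b′ :* b) :+ a′ :* (b′ :* b) :+ u :* (b :+ b′))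
                 := e :* (b :* a :+ u) :* b′ :+ e :* (b′ :* a′ :+ u) :* b) refl e a a′ U b b′ ⟩
          p * b′ + s * b ∎

        ρ⟨b⟩ᵠ⁺¹≈U : ρ ⟨ b ⟩ * pow (ρ ⟨ b ⟩) q ≈ U
        ρ⟨b⟩ᵠ⁺¹≈U = begin
          ρ ⟨ b ⟩ * pow (ρ ⟨ b ⟩) q
            ≈⟨ *-cong ρ⟨b⟩≈pb′+sb (trans (pow-congˡ q ρ⟨b⟩≈pb′+sb) (split-frobenius (suc k) b′ b)) ⟩
          (p * b′ + s * b) * (p * a′ + s * a)
            ≈⟨ split-* b′ b a′ a ⟩
          p * V′ + s * V
            ≈⟨ solve 4 (λ e v v′ u → e :* (v :+ u) :* v′ :+ e :* (v′ :+ u) :* v := u :* (e :* (v :+ v′)))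
                 refl e V V′ U ⟩
          U * (e * (V + V′))
            ≈⟨ trans (*-congˡ e[V+V′]≈1) (*-identityʳ U) ⟩
          U ∎

        ⟨ρ⟨b⟩⟩≃⟨b⟩ : ⟨ ρ ⟨ b ⟩ ⟩≃ ⟨ b ⟩
        ⟨ρ⟨b⟩⟩≃⟨b⟩ = begin
          ρ ⟨ b ⟩ * (b + b′)
            ≈⟨ *-congʳ ρ⟨b⟩≈pb′+sb ⟩
          (p * b′ + s * b) * (b + b′)
            ≈⟨ solve 4 (λ p s b b′ → (p :* b′ :+ s :* b) :* (b :+ b′)
                 := (p :+ s) :* (b′ :* b) :+ (p :* (b′ :* b′) :+ s :* (b :* b))) refl p s b b′ ⟩
          (p + s) * (b′ * b) + (p * (b′ * b′) + s * (b * b))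
            ≈⟨ +-cong (*-cong p+s≈1 b′b≈1) (sym (split-* b′ b b′ b)) ⟩
          1# * 1# + (p * b′ + s * b) * (p * b′ + s * b)
            ≈⟨ +-comm _ _ ⟩
          (p * b′ + s * b) * (p * b′ + s * b) + 1# * 1#
            ≈⟨ +-cong (*-cong ρ⟨b⟩≈pb′+sb ρ⟨b⟩≈pb′+sb) (sym (*-identityˡ 1#)) ⟨
          ρ ⟨ b ⟩ * ρ ⟨ b ⟩ + 1# ∎

      conjugate⇒Q-root : ∀ {w} → w * pow w q ≈ U →
                         ⟨ w ⟩ * ⟨ w ⟩ * t (pow ⟨ w ⟩ (q ∸ 1)) ≈ 1# × Q (pow ⟨ w ⟩ (q ∸ 1)) ≈ 0#
      conjugate⇒Q-root {w} wwᵠ≈U =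
        zzt≈1 , Equivalence.from (ConjugateRoot.Q≈0⇔e≃⟨V⟩⁻¹ ⟨w⟩≃⟨w⟩ zy≈zᵠ zzt≈1) e≃⟨V⟩⁻¹
        where
        ⟨w⟩≃⟨w⟩ : ⟨ w ⟩≃ ⟨ w ⟩
        ⟨w⟩≃⟨w⟩ = ⟨⟩-≃ (conjugate-≉0 wwᵠ≈U)
        zy≈zᵠ : ⟨ w ⟩ * pow ⟨ w ⟩ (q ∸ 1) ≈ pow ⟨ w ⟩ q
        zy≈zᵠ = *-pow-pred ⟨ w ⟩ q
        e≃⟨V⟩⁻¹ : e≃⟨ w * pow w q ⟩⁻¹
        e≃⟨V⟩⁻¹ = e≃⟨⟩⁻¹-cong (sym wwᵠ≈U) e≃⟨U⟩⁻¹
        zzt≈1 : ⟨ w ⟩ * ⟨ w ⟩ * t (pow ⟨ w ⟩ (q ∸ 1)) ≈ 1#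
        zzt≈1 = e≃⟨⟩⁻¹⇒zzt≈1 ⟨w⟩≃⟨w⟩ zy≈zᵠ e≃⟨V⟩⁻¹

      Q-roots : IsAlgClosed K → ∀ y → Q y ≈ 0# ⇔ ∃ λ w → w * pow w q ≈ U × y ≈ pow ⟨ w ⟩ (q ∸ 1)
      Q-roots closed y = mk⇔ (λ Qy≈0 → conjugate (Q-root⇒conjugate closed Qy≈0)) root
        where
        conjugate : (∃ λ b → ¬ b ≈ 0# × e≃⟨ b * pow b q ⟩⁻¹ × y ≈ pow ⟨ b ⟩ (q ∸ 1)) →
                    ∃ λ w → w * pow w q ≈ U × y ≈ pow ⟨ w ⟩ (q ∸ 1)
        conjugate (b , b≉0 , e≃⟨V⟩⁻¹ , y≈) =
          ρ ⟨ b ⟩ , ρ⟨b⟩ᵠ⁺¹≈U , trans y≈ (pow-congˡ (q ∸ 1) (⟨⟩≃⇒≈⟨⟩ ⟨ρ⟨b⟩⟩≃⟨b⟩))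
          where open Splitting b≉0 e≃⟨V⟩⁻¹
        root : (∃ λ w → w * pow w q ≈ U × y ≈ pow ⟨ w ⟩ (q ∸ 1)) → Q y ≈ 0#
        root (w , wwᵠ≈U , y≈) = trans (Q-cong y≈) (proj₂ (conjugate⇒Q-root wwᵠ≈U))

      conjugate-injective : ∀ {w₁ w₂} → w₁ * pow w₁ q ≈ U → w₂ * pow w₂ q ≈ U →
                            pow ⟨ w₁ ⟩ (q ∸ 1) ≈ pow ⟨ w₂ ⟩ (q ∸ 1) → w₁ ≈ w₂
      conjugate-injective {w₁} {w₂} w₁w₁ᵠ≈U w₂w₂ᵠ≈U y₁≈y₂ = begin
        w₁        ≈⟨ ρ-⟨⟩ (⟨⟩-≃ (conjugate-≉0 w₁w₁ᵠ≈U)) w₁w₁ᵠ≈U ⟨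
        ρ ⟨ w₁ ⟩  ≈⟨ ρ-cong ⟨w₁⟩≈⟨w₂⟩ ⟩
        ρ ⟨ w₂ ⟩  ≈⟨ ρ-⟨⟩ (⟨⟩-≃ (conjugate-≉0 w₂w₂ᵠ≈U)) w₂w₂ᵠ≈U ⟩
        w₂        ∎
        where
        ⟨w⟩*κ≈1 : ∀ {w} → w * pow w q ≈ U → ⟨ w ⟩ * κ (pow ⟨ w ⟩ (q ∸ 1)) ≈ 1#
        ⟨w⟩*κ≈1 wwᵠ≈U = z*κ≈1 (*-pow-pred _ q) (proj₁ (conjugate⇒Q-root wwᵠ≈U))
        ⟨w₁⟩≈⟨w₂⟩ : ⟨ w₁ ⟩ ≈ ⟨ w₂ ⟩
        ⟨w₁⟩≈⟨w₂⟩ = *-cancelʳ (*≈1⇒≉0 (trans (*-comm _ _) (⟨w⟩*κ≈1 w₁w₁ᵠ≈U)))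
          (trans (⟨w⟩*κ≈1 w₁w₁ᵠ≈U) (sym (trans (*-congˡ (κ-cong y₁≈y₂)) (⟨w⟩*κ≈1 w₂w₂ᵠ≈U))))

    τ c₀ : Carrier
    τ  = T (suc k) e
    c₀ = e * pow τ 2

    module Roots (closed : IsAlgClosed K) {a} (a≉0 : ¬ a ≈ 0#) (a≈ : a ≈ e * pow τ (suc q))
                 {u} (⟨U⟩≈e⁻¹ : ⟨ pow u (suc q) ⟩ ≈ e ⁻¹) where

      P : Carrier → Carrier
      P x = pow x (suc q) + (a * a) * x + a * a

      P-cong : ∀ {x x′} → x ≈ x′ → P x ≈ P x′
      P-cong x≈x′ = +-congʳ (+-cong (pow-congˡ (suc q) x≈x′) (*-congˡ x≈x′))

      τ≉0 : ¬ τ ≈ 0#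
      τ≉0 τ≈0 = a≉0 (trans a≈ (trans (*-congˡ (trans (*-congʳ τ≈0) (zeroˡ _))) (zeroʳ e)))

      c₀≉0 : ¬ c₀ ≈ 0#
      c₀≉0 = *-≉0 e≉0 (pow-≉0 2 τ≉0)

      τᵠ : Carrier
      τᵠ = pow τ q

      P-scaling : ∀ y → P (c₀ * y) ≈ e * (τ * τ) * (τᵠ * τᵠ) * Q y
      P-scaling y = begin
        P (c₀ * y)
          ≈⟨ +-cong (+-cong (*-congˡ c₀yᵠ≈) (*-congʳ (*-cong a≈ a≈))) (*-cong a≈ a≈) ⟩
        c₀ * y * (pow e q * (τᵠ * τᵠ) * pow y q) + e * (τ * τᵠ) * (e * (τ * τᵠ)) * (c₀ * y)
          + e * (τ * τᵠ) * (e * (τ * τᵠ))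
          ≈⟨ solve 6 (λ e τ τᵠ y eᵠ yᵠ →
               e :* (τ :* (τ :* con true)) :* y :* (eᵠ :* (τᵠ :* τᵠ) :* yᵠ)
               :+ e :* (τ :* τᵠ) :* (e :* (τ :* τᵠ)) :* (e :* (τ :* (τ :* con true)) :* y)
               :+ e :* (τ :* τᵠ) :* (e :* (τ :* τᵠ))
             := e :* (τ :* τ) :* (τᵠ :* τᵠ) :* (eᵠ :* yᵠ :* y :+ e :* τ :* (e :* τ) :* y :+ e))
             refl e τ τᵠ y (pow e q) (pow y q) ⟩
        e * (τ * τ) * (τᵠ * τᵠ) * (pow e q * pow y q * y + e * τ * (e * τ) * y + e)
          ≈⟨ *-congˡ (+-congʳ (+-cong (*-congʳ (pow-distrib-* e y q)) (*-congʳ (*-cong L≈eτ L≈eτ)))) ⟨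
        e * (τ * τ) * (τᵠ * τᵠ) * Q y ∎
        where
        L≈eτ : L ≈ e * τ
        L≈eτ = sym (*-T≈Tr (suc k) e)
        c₀yᵠ≈ : pow (c₀ * y) q ≈ pow e q * (τᵠ * τᵠ) * pow y q
        c₀yᵠ≈ = trans (pow-distrib-* c₀ y q) (*-congʳ (trans (pow-distrib-* e (pow τ 2) q)
                  (*-congˡ (trans (pow-congˡ q (*-congˡ (*-identityʳ τ))) (pow-distrib-* τ τ q)))))

      P≈0⇔Q≈0 : ∀ x → P x ≈ 0# ⇔ Q (c₀ ⁻¹ * x) ≈ 0#
      P≈0⇔Q≈0 x =
        proportional⇒≈0⇔≈0 1≉0 (*-≉0 (*-≉0 e≉0 (*-≉0 τ≉0 τ≉0)) (*-≉0 τᵠ≉0 τᵠ≉0)) 1*Px≈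
        where
        τᵠ≉0 : ¬ τᵠ ≈ 0#
        τᵠ≉0 = pow-≉0 q τ≉0
        1*Px≈ : 1# * P x ≈ e * (τ * τ) * (τᵠ * τᵠ) * Q (c₀ ⁻¹ * x)
        1*Px≈ = trans (*-identityˡ (P x))
                  (trans (P-cong (Equivalence.to (⁻¹*≈⇔≈* c₀≉0) refl)) (P-scaling (c₀ ⁻¹ * x)))

      U : Carrier
      U = pow u (suc q)

      open Conjugates (⟨⟩≈e⁻¹⇒e≃⟨⟩⁻¹ ⟨U⟩≈e⁻¹)

      u≉0 : ¬ u ≈ 0#
      u≉0 u≈0 = U≉0 (trans (pow-congˡ (suc q) u≈0) (pow-0# q))

      μ⇒conjugate : ∀ {ζ} → μ (suc q) ζ → ζ * u * pow (ζ * u) q ≈ U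
      μ⇒conjugate {ζ} ζᵠ⁺¹≈1 =
        trans (pow-distrib-* ζ u (suc q)) (trans (*-congʳ ζᵠ⁺¹≈1) (*-identityˡ U))

      conjugate⇒μ : ∀ {w} → w * pow w q ≈ U → μ (suc q) (w * u ⁻¹)
      conjugate⇒μ {w} wwᵠ≈U = begin
        pow (w * u ⁻¹) (suc q)              ≈⟨ pow-distrib-* w (u ⁻¹) (suc q) ⟩
        pow w (suc q) * pow (u ⁻¹) (suc q)  ≈⟨ trans (*-congʳ wwᵠ≈U) (*-comm U _) ⟩
        pow (u ⁻¹) (suc q) * U              ≈⟨ pow-⁻¹ (suc q) u≉0 ⟩
        1#                                  ∎

      conjugates⇔μ : ∀ x → (∃ λ w → w * pow w q ≈ U × c₀ ⁻¹ * x ≈ pow ⟨ w ⟩ (q ∸ 1))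
                          ⇔ (∃ λ ζ → μ (suc q) ζ × x ≈ c₀ * pow ⟨ ζ * u ⟩ (q ∸ 1))
      conjugates⇔μ x = mk⇔
        (λ (w , wwᵠ≈U , y≈) → w * u ⁻¹ , conjugate⇒μ wwᵠ≈U ,
           trans (Equivalence.to (⁻¹*≈⇔≈* c₀≉0) y≈)
                 (*-congˡ (pow-congˡ (q ∸ 1) (⟨⟩-cong (sym wu⁻¹u≈w)))))
        (λ (ζ , μζ , x≈) → ζ * u , μ⇒conjugate μζ , Equivalence.from (⁻¹*≈⇔≈* c₀≉0) x≈)
        where
        wu⁻¹u≈w : ∀ {w} → w * u ⁻¹ * u ≈ w
        wu⁻¹u≈w {w} = trans (*-assoc w (u ⁻¹) u) (trans (*-congˡ (⁻¹-inverseˡ u≉0)) (*-identityʳ w))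

      roots : ∀ x → P x ≈ 0# ⇔ ∃ λ ζ → μ (suc q) ζ × x ≈ c₀ * pow ⟨ ζ * u ⟩ (q ∸ 1)
      roots x = conjugates⇔μ x ⇔-∘ (Q-roots closed (c₀ ⁻¹ * x) ⇔-∘ P≈0⇔Q≈0 x)

      roots-distinct : ∀ ζ₁ ζ₂ → μ (suc q) ζ₁ → μ (suc q) ζ₂ →
                       c₀ * pow ⟨ ζ₁ * u ⟩ (q ∸ 1) ≈ c₀ * pow ⟨ ζ₂ * u ⟩ (q ∸ 1) → ζ₁ ≈ ζ₂
      roots-distinct ζ₁ ζ₂ μζ₁ μζ₂ c₀y₁≈c₀y₂ =
        *-cancelʳ u≉0
          (conjugate-injective (μ⇒conjugate μζ₁) (μ⇒conjugate μζ₂) (*-cancelˡ c₀≉0 c₀y₁≈c₀y₂))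

proposition2p6 : ∀ {c ℓ} (K : Field c ℓ) → Char2 K → IsAlgClosed K →
    let open Field K
        open FieldOps K
    in (n : ℕ) → 1 < n →
       (a e u : Carrier) → ¬ (a ≈ 0#) →
       C n e + a ≈ 0# →
       pow u (suc (2 ^ n)) + (pow u (suc (2 ^ n))) ⁻¹ ≈ e ⁻¹ →
       ((x : Carrier) →
          (pow x (suc (2 ^ n)) + (a * a) * x + a * a ≈ 0#)
          ⇔ (∃ λ ζ → μ (suc (2 ^ n)) ζ ×
                (x ≈ (e * pow (T n e) 2) * pow ⟨ ζ * u ⟩ (2 ^ n ∸ 1))))
       × ((ζ₁ ζ₂ : Carrier) → μ (suc (2 ^ n)) ζ₁ → μ (suc (2 ^ n)) ζ₂ →
          (e * pow (T n e) 2) * pow ⟨ ζ₁ * u ⟩ (2 ^ n ∸ 1)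
            ≈ (e * pow (T n e) 2) * pow ⟨ ζ₂ * u ⟩ (2 ^ n ∸ 1) →
          ζ₁ ≈ ζ₂)
proposition2p6 K char2 closed (suc k) _ a e u a≉0 Ce+a≈0 ⟨U⟩≈e⁻¹ = roots , roots-distinct
  where
  open Field K
  open FieldOps K
  open CharacteristicTwo K char2

  a≈eτᵠ⁺¹ : a ≈ e * pow (T (suc k) e) (suc (2 ^ suc k))
  a≈eτᵠ⁺¹ = sym (+≈0⇒≈ Ce+a≈0)

  e≉0 : ¬ e ≈ 0#
  e≉0 e≈0 = a≉0 (trans a≈eτᵠ⁺¹ (trans (*-congʳ e≈0) (zeroˡ _)))

  open Setting k e≉0
  open Roots closed a≉0 a≈eτᵠ⁺¹ ⟨U⟩≈e⁻¹
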